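{- Let $d\ge2$ and $n\ge0$ be integers. Then the map $\mathrm{pre}_2$ is injective on $\mathcal P_2(n,d)$.
   Context: A partition is a weakly decreasing sequence $\lambda=(\lambda_1,\dots,\lambda_\ell)$ of positive integers. A $d$-ary partition is a partition all of whose parts are powers of $d$ (including $1=d^0$). $\mathcal P_2(n,d)$ is the set of $d$-ary partitions of $n$ with at least $2$ parts. For $\lambda$ with $\ell\ge2$, $\mathrm{pre}_2(\lambda)$ is the partition whose parts are the products $\lambda_i\lambda_j$, $1\le i<j\le\ell$. -}

module Defs where

open import Data.Nat using (ℕ; zero; suc; _+_; _*_; _^_; _≤_; _≥_)
open import Data.List using (List; []; _∷_; map; length; _++_)
open import Data.Nat.ListAction using (sum)
open import Data.List.Relation.Unary.All using (All)
open import Data.List.Relation.Unary.Linked using (Linked)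
open import Data.Product using (∃; _×_)
open import Relation.Binary.PropositionalEquality using (_≡_)

IsPartition : List ℕ → Set
IsPartition l = Linked _≥_ l × All (λ x → 1 ≤ x) l

IsPowerOf : ℕ → ℕ → Set
IsPowerOf d x = ∃ λ k → x ≡ d ^ k

InP2 : ℕ → ℕ → List ℕ → Set
InP2 n d l = IsPartition l × All (IsPowerOf d) l × sum l ≡ n × 2 ≤ length l

-- the multiset of products λ_i λ_j, i < j, as a list
pre2 : List ℕ → List ℕ
pre2 []       = []
pre2 (x ∷ xs) = map (x *_) xs ++ pre2 xs

{-# OPTIONS --safe #-}
module Submission where

-- Squaring the power sum p_k(λ) = Σ λ_i^k gives p_{2k}(λ) + 2 p_k(pre₂ λ), so pre₂ λ together
-- with p_1(λ) = n determines every power sum p_{2^j}(λ).  For d-ary partitions these power sums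
-- determine the partition: two distinct powers of d differ by a factor of at least d, so for
-- d^k larger than the number of parts, the k-th power of a part exceeds the combined k-th
-- powers of all parts strictly smaller than it, and the parts can be compared from the largest
-- down.

open import Defs
open import Data.Nat using (ℕ; zero; suc; _+_; _*_; _^_; _≤_; _<_; _≥_; z≤n; z<s; >-nonZero)
open import Data.Nat.Properties
open import Data.Nat.ListAction using (sum)
open import Data.Nat.ListAction.Properties using (sum-++; sum-↭)
open import Data.Nat.Solver using (module +-*-Solver)
open import Data.List using (List; []; _∷_; map; length; _++_)
open import Data.List.Properties using (map-++; map-cong; map-id; length-map)
open import Data.List.Relation.Unary.All as All using (All; []; _∷_)
open import Data.List.Relation.Unary.All.Properties using (map⁺)
open import Data.List.Relation.Unary.Linked as Linked using (Linked)
open import Data.List.Relation.Unary.Linked.Properties using (Linked⇒All)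
open import Data.List.Relation.Binary.Permutation.Propositional using (_↭_)
import Data.List.Relation.Binary.Permutation.Propositional.Properties as ↭
open import Data.Product using (_,_)
open import Data.Empty using (⊥-elim)
open import Function using (_∘_)
open import Relation.Binary using (tri<; tri≈; tri>)
open import Relation.Binary.Properties.Poset ≤-poset using (≥-trans)
open import Relation.Binary.PropositionalEquality using (_≡_; refl; sym; trans; cong; cong₂; module ≡-Reasoning)
open import Relation.Nullary using (¬_)

^-distrib-* : ∀ x y k → (x * y) ^ k ≡ x ^ k * y ^ k
^-distrib-* x y zero = refl
^-distrib-* x y (suc k) = begin
  x * y * (x * y) ^ k      ≡⟨ cong (x * y *_) (^-distrib-* x y k) ⟩
  x * y * (x ^ k * y ^ k)  ≡⟨ solve 4 (λ a b c e → a :* b :* (c :* e) := a :* c :* (b :* e)) refl x y (x ^ k) (y ^ k) ⟩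
  x * x ^ k * (y * y ^ k)  ∎
  where open ≡-Reasoning; open +-*-Solver

n<m^n : ∀ {m} → 1 < m → ∀ n → n < m ^ n
n<m^n 1<m zero = z<s
n<m^n {m} 1<m (suc n) = ≤-<-trans (n<m^n 1<m n) (^-monoʳ-< m 1<m (n<1+n n))

IsPowerOf-pos : ∀ {d x} → 1 < d → IsPowerOf d x → 0 < x
IsPowerOf-pos {d} 1<d (b , refl) = m^n>0 d {{>-nonZero (<-trans z<s 1<d)}} b

IsPowerOf-<⇒*≤ : ∀ {d x y} → 1 < d → IsPowerOf d x → IsPowerOf d y → x < y → d * x ≤ y
IsPowerOf-<⇒*≤ {d} 1<d (a , refl) (b , refl) dᵃ<dᵇ =
  ^-monoʳ-≤ d {suc a} {b} (≰⇒> (λ b≤a → <⇒≱ dᵃ<dᵇ (^-monoʳ-≤ d b≤a)))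
  where instance _ = >-nonZero (<-trans z<s 1<d)

powerSum : ℕ → List ℕ → ℕ
powerSum k l = sum (map (_^ k) l)

powerSum-1 : ∀ l → powerSum 1 l ≡ sum l
powerSum-1 l = cong sum (trans (map-cong *-identityʳ l) (map-id l))

powerSum-↭ : ∀ k {l m} → l ↭ m → powerSum k l ≡ powerSum k m
powerSum-↭ k l↭m = sum-↭ (↭.map⁺ (_^ k) l↭m)

powerSum-++ : ∀ k l m → powerSum k (l ++ m) ≡ powerSum k l + powerSum k m
powerSum-++ k l m = trans (cong sum (map-++ (_^ k) l m)) (sum-++ (map (_^ k) l) (map (_^ k) m))

powerSum-map-*ˡ : ∀ k x l → powerSum k (map (x *_) l) ≡ x ^ k * powerSum k l
powerSum-map-*ˡ k x [] = sym (*-zeroʳ (x ^ k))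
powerSum-map-*ˡ k x (y ∷ l) = begin
  (x * y) ^ k + powerSum k (map (x *_) l)  ≡⟨ cong₂ _+_ (^-distrib-* x y k) (powerSum-map-*ˡ k x l) ⟩
  x ^ k * y ^ k + x ^ k * powerSum k l     ≡⟨ sym (*-distribˡ-+ (x ^ k) (y ^ k) (powerSum k l)) ⟩
  x ^ k * (y ^ k + powerSum k l)           ∎
  where open ≡-Reasoning

powerSum-≤ : ∀ k {y} l → All (_≤ y) l → powerSum k l ≤ length l * y ^ k
powerSum-≤ k [] [] = z≤n
powerSum-≤ k (x ∷ l) (x≤y ∷ l≤y) = +-mono-≤ (^-monoˡ-≤ k x≤y) (powerSum-≤ k l l≤y)

powerSum-square : ∀ k l → powerSum k l * powerSum k l ≡ powerSum (2 * k) l + 2 * powerSum k (pre2 l)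
powerSum-square k [] = refl
powerSum-square k (x ∷ l) = begin
  (a + s) * (a + s)                ≡⟨ solve 2 (λ a s → (a :+ s) :* (a :+ s) := a :* a :+ con 2 :* a :* s :+ s :* s) refl a s ⟩
  a * a + 2 * a * s + s * s        ≡⟨ cong (a * a + 2 * a * s +_) (powerSum-square k l) ⟩
  a * a + 2 * a * s + (q + 2 * p)  ≡⟨ solve 4 (λ a q s p → a :* a :+ con 2 :* a :* s :+ (q :+ con 2 :* p)
                                                         := a :* a :+ q :+ con 2 :* (a :* s :+ p)) refl a q s p ⟩
  a * a + q + 2 * (a * s + p)      ≡⟨ cong₂ (λ u v → u + q + 2 * v) (sym x^2k≡a*a) (sym pre2-∷) ⟩
  x ^ (2 * k) + q + 2 * powerSum k (pre2 (x ∷ l)) ∎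
  where
  open ≡-Reasoning; open +-*-Solver
  a = x ^ k
  s = powerSum k l
  q = powerSum (2 * k) l
  p = powerSum k (pre2 l)
  x^2k≡a*a : x ^ (2 * k) ≡ a * a
  x^2k≡a*a = trans (^-distribˡ-+-* x k (k + 0)) (cong (λ e → a * x ^ e) (+-identityʳ k))
  pre2-∷ : powerSum k (pre2 (x ∷ l)) ≡ a * s + p
  pre2-∷ = trans (powerSum-++ k (map (x *_) l) (pre2 l)) (cong (_+ p) (powerSum-map-*ˡ k x l))

pre2-powerSum-double : ∀ k l m → pre2 l ↭ pre2 m → powerSum k l ≡ powerSum k m →
                       powerSum (2 * k) l ≡ powerSum (2 * k) m
pre2-powerSum-double k l m pre↭ pₖ≡ = +-cancelʳ-≡ _ _ _ (begin
  powerSum (2 * k) l + 2 * powerSum k (pre2 l)  ≡⟨ sym (powerSum-square k l) ⟩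
  powerSum k l * powerSum k l                   ≡⟨ cong₂ _*_ pₖ≡ pₖ≡ ⟩
  powerSum k m * powerSum k m                   ≡⟨ powerSum-square k m ⟩
  powerSum (2 * k) m + 2 * powerSum k (pre2 m)  ≡⟨ cong (λ z → powerSum (2 * k) m + 2 * z) (sym (powerSum-↭ k pre↭)) ⟩
  powerSum (2 * k) m + 2 * powerSum k (pre2 l)  ∎)
  where open ≡-Reasoning

PowerSumsAgree : List ℕ → List ℕ → Set
PowerSumsAgree l m = ∀ j → powerSum (2 ^ j) l ≡ powerSum (2 ^ j) m

pre2-powerSumsAgree : ∀ l m → pre2 l ↭ pre2 m → sum l ≡ sum m → PowerSumsAgree l m
pre2-powerSumsAgree l m pre↭ sum≡ zero = trans (powerSum-1 l) (trans sum≡ (sym (powerSum-1 m)))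
pre2-powerSumsAgree l m pre↭ sum≡ (suc j) =
  pre2-powerSum-double (2 ^ j) l m pre↭ (pre2-powerSumsAgree l m pre↭ sum≡ j)

powerSum-<-^ : ∀ {d y} k l → length l < d ^ k → 0 < y → All (λ x → d * x ≤ y) l → powerSum k l < y ^ k
powerSum-<-^ {d} {y} k l l<dᵏ 0<y dl≤y = *-cancelˡ-< (d ^ k) (powerSum k l) (y ^ k) (begin-strict
  d ^ k * powerSum k l           ≡⟨ sym (powerSum-map-*ˡ k d l) ⟩
  powerSum k (map (d *_) l)      ≤⟨ powerSum-≤ k (map (d *_) l) (map⁺ dl≤y) ⟩
  length (map (d *_) l) * y ^ k  ≡⟨ cong (_* y ^ k) (length-map (d *_) l) ⟩
  length l * y ^ k               <⟨ *-monoˡ-< (y ^ k) {{>-nonZero (m^n>0 y {{>-nonZero 0<y}} k)}} l<dᵏ ⟩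
  d ^ k * y ^ k                  ∎)
  where open ≤-Reasoning

¬PowerSumsAgree-[]-∷ : ∀ {y} ys → 0 < y → ¬ PowerSumsAgree [] (y ∷ ys)
¬PowerSumsAgree-[]-∷ {y} ys 0<y agree =
  <⇒≢ (<-≤-trans 0<y (m≤m+n y (sum ys))) (trans (agree 0) (powerSum-1 (y ∷ ys)))

-- Any exponent k with N < d ^ k separates the two lists; k = 2 ^ N is one at which they agree.
¬PowerSumsAgree-head< : ∀ {d x y} xs ys → 1 < d → IsPowerOf d x → IsPowerOf d y → x < y →
                         Linked _≥_ (x ∷ xs) → ¬ PowerSumsAgree (x ∷ xs) (y ∷ ys)
¬PowerSumsAgree-head< {d} {x} {y} xs ys 1<d x-pow y-pow x<y x∷xs↘ agree = <⇒≢ pₖ< (agree N)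
  where
  N = length (x ∷ xs)
  k = 2 ^ N
  N<dᵏ : N < d ^ k
  N<dᵏ = ≤-<-trans (<⇒≤ (n<m^n ≤-refl N)) (n<m^n 1<d k)
  d*parts≤y : All (λ z → d * z ≤ y) (x ∷ xs)
  d*parts≤y = All.map (λ z≤x → ≤-trans (*-monoʳ-≤ d z≤x) (IsPowerOf-<⇒*≤ 1<d x-pow y-pow x<y))
                      (Linked⇒All ≥-trans ≤-refl x∷xs↘)
  pₖ< : powerSum k (x ∷ xs) < powerSum k (y ∷ ys)
  pₖ< = <-≤-trans (powerSum-<-^ k (x ∷ xs) N<dᵏ (IsPowerOf-pos 1<d y-pow) d*parts≤y)
                  (m≤m+n (y ^ k) (powerSum k ys))

descendingPowers-injective : ∀ {d} → 1 < d → ∀ l m → Linked _≥_ l → Linked _≥_ m →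
                             All (IsPowerOf d) l → All (IsPowerOf d) m → PowerSumsAgree l m → l ≡ m
descendingPowers-injective 1<d [] [] _ _ _ _ _ = refl
descendingPowers-injective 1<d [] (y ∷ ys) _ _ _ (y-pow ∷ _) agree =
  ⊥-elim (¬PowerSumsAgree-[]-∷ ys (IsPowerOf-pos 1<d y-pow) agree)
descendingPowers-injective 1<d (x ∷ xs) [] _ _ (x-pow ∷ _) _ agree =
  ⊥-elim (¬PowerSumsAgree-[]-∷ xs (IsPowerOf-pos 1<d x-pow) (sym ∘ agree))
descendingPowers-injective 1<d (x ∷ xs) (y ∷ ys) l↘ m↘ (x-pow ∷ xs-pow) (y-pow ∷ ys-pow) agree
  with <-cmp x y
... | tri< x<y _ _ = ⊥-elim (¬PowerSumsAgree-head< xs ys 1<d x-pow y-pow x<y l↘ agree)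
... | tri> _ _ y<x = ⊥-elim (¬PowerSumsAgree-head< ys xs 1<d y-pow x-pow y<x m↘ (sym ∘ agree))
... | tri≈ _ refl _ = cong (x ∷_) (descendingPowers-injective 1<d xs ys (Linked.tail l↘) (Linked.tail m↘)
                                     xs-pow ys-pow (λ j → +-cancelˡ-≡ (x ^ (2 ^ j)) _ _ (agree j)))

theorem3p2 : (d n : ℕ) → 2 ≤ d → (l m : List ℕ) → InP2 n d l → InP2 n d m →
    pre2 l ↭ pre2 m → l ≡ m
theorem3p2 d n 1<d l m ((l↘ , _) , l-pow , sum-l , _) ((m↘ , _) , m-pow , sum-m , _) pre↭ =
  descendingPowers-injective 1<d l m l↘ m↘ l-pow m-pow (pre2-powerSumsAgree l m pre↭ (trans sum-l (sym sum-m)))
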